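{- Let $a\ge1$ be an integer and $m\ge2$ an even integer. Then $$\liminf_{n\to \infty}\frac{\#\{1\le k\le n\mid\mathrm{cp}_{a,a,m}(k) \text{ is even}\}}{n}\ge\frac{1}{2}.$$
   Context: For integers $a,b,m\ge1$, an $(a,b,m)$-copartition is a triple of integer partitions $(\gamma,\rho,\sigma)$ such that every part of $\gamma$ is $\ge a$ and $\equiv a \pmod m$, every part of $\sigma$ is $\ge b$ and $\equiv b\pmod m$, and $\rho$ has exactly as many parts as $\sigma$, each part of $\rho$ being equal to $m$ times the number of parts of $\gamma$. Its size is the sum of all parts of $\gamma,\rho,\sigma$, and $\mathrm{cp}_{a,b,m}(n)$ denotes the number of $(a,b,m)$-copartitions of size $n$. -}

module Defs where

open import Data.Nat using (ℕ; zero; suc; _+_; _*_; _∸_; _≤_; _≤?_; _≟_)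
open import Data.Nat.Divisibility using (_∣_; _∣?_)
open import Data.Bool using (Bool; true; false; if_then_else_; _∧_)
open import Data.List using (List; []; _∷_; [_]; map; concatMap; length; filter; upTo)
open import Data.Nat.ListAction using (sum)
open import Data.Product using (_×_; _,_; proj₁; proj₂)
open import Relation.Nullary.Decidable using (⌊_⌋)

-- An integer partition is represented as a weakly decreasing list of positive parts.
-- ptns P f n k : all weakly decreasing lists of positive integers, each satisfying P,
-- each ≤ k, summing to n (f is fuel; f = n suffices since every part is ≥ 1).
ptns : (ℕ → Bool) → ℕ → ℕ → ℕ → List (List ℕ)
ptns P zero zero k = [ [] ]
ptns P zero (suc n) k = []
ptns P (suc f) zero k = [ [] ]
ptns P (suc f) (suc n) k =
  concatMap (λ p → if P p ∧ ⌊ p ≤? suc n ⌋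
                     then map (p ∷_) (ptns P f (suc n ∸ p) p)
                     else [])
            (map suc (upTo k))

partitions : (ℕ → Bool) → ℕ → List (List ℕ)
partitions P n = ptns P n n n

admissible : ℕ → ℕ → ℕ → Bool
admissible c m p = ⌊ c ≤? p ⌋ ∧ ⌊ m ∣? (p ∸ c) ⌋

Copart : Set
Copart = List ℕ × List ℕ × List ℕ

size : Copart → ℕ
size (γ , ρ , σ) = sum γ + sum ρ + sum σ

-- ρ is forced: length σ parts, each equal to m * (number of parts of γ)
rhoOf : ℕ → List ℕ → List ℕ → List ℕ
rhoOf m γ σ = map (λ _ → m * length γ) σ

copartitions : ℕ → ℕ → ℕ → ℕ → List Copart
copartitions a b m n =
  filter (λ c → size c ≟ n)
    (concatMap (λ n₁ →
      concatMap (λ n₃ →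
        concatMap (λ γ →
          map (λ σ → (γ , rhoOf m γ σ , σ))
              (partitions (admissible b m) n₃))
          (partitions (admissible a m) n₁))
        (upTo (suc n)))
      (upTo (suc n)))

cp : ℕ → ℕ → ℕ → ℕ → ℕ
cp a b m n = length (copartitions a b m n)

evenCount : ℕ → ℕ → ℕ → ℕ
evenCount a m n = length (filter (λ k → 2 ∣? cp a a m k) (map suc (upTo n)))

{-# OPTIONS --safe #-}
module Submission where

-- Swapping γ and σ is an involution on (a,a,m)-copartitions: the ρ-part contributes
-- m·|γ|·|σ| to the size, symmetrically in γ and σ.  A fixed point (γ,ρ,γ) has size
-- 2·Σγ + m·|γ|², which is even when m is, so cp_{a,a,m}(n) is even for every odd n; here the
-- involution appears as a double sum, over pairs (γ,σ), of a symmetric term whose diagonal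
-- vanishes.  Hence at least half of 1,…,n have an even count, for every n.

open import Defs
open import Data.Nat using (ℕ; zero; suc; _+_; _*_; _∸_; _≤_; _≟_; z≤n; s≤s)
open import Data.Nat.Properties
  using (+-comm; *-zeroʳ; *-suc; m≤m+n; m≤n+m; m∸n≤m;
         *-monoˡ-≤; *-monoʳ-≤; ≤-trans; ≤-reflexive; module ≤-Reasoning)
open import Data.Nat.Divisibility using (_∣_; _∣?_; divides; _∣0; m∣m*n; ∣m∣n⇒∣m+n; ∣m+n∣m⇒∣n; ∣1⇒≡1)
open import Data.Nat.ListAction using (sum)
open import Data.Nat.Tactic.RingSolver using (solve-∀)
open import Data.List using (List; []; _∷_; [_]; _++_; map; concatMap; filter; length; upTo)
open import Data.List.Properties using (length-++; filter-++; map-++; map-cong; upTo-∷ʳ)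
open import Data.Product using (∃; _,_)
open import Data.Sum using (_⊎_; inj₁; inj₂)
open import Function using (_∘_)
open import Level using (Level)
open import Relation.Nullary using (Dec; yes; no; ¬_; contradiction)
open import Relation.Unary using (Pred; Decidable)
open import Relation.Binary.PropositionalEquality using (_≡_; refl; sym; trans; cong; cong₂; subst; module ≡-Reasoning)

private variable
  ℓ : Level
  A B : Set

sum-map-const : (c : ℕ) (xs : List A) → sum (map (λ _ → c) xs) ≡ length xs * c
sum-map-const c []       = refl
sum-map-const c (x ∷ xs) = cong (c +_) (sum-map-const c xs)

sum-map-cong : {f g : A → ℕ} → (∀ x → f x ≡ g x) → (xs : List A) → sum (map f xs) ≡ sum (map g xs)
sum-map-cong f≗g xs = cong sum (map-cong f≗g xs)

sum-map-+ : (f g : A → ℕ) (xs : List A) →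
  sum (map (λ x → f x + g x) xs) ≡ sum (map f xs) + sum (map g xs)
sum-map-+ f g []       = refl
sum-map-+ f g (x ∷ xs) =
  trans (cong (f x + g x +_) (sum-map-+ f g xs))
        (interchange (f x) (g x) (sum (map f xs)) (sum (map g xs)))
  where
  interchange : ∀ p q r s → p + q + (r + s) ≡ p + r + (q + s)
  interchange = solve-∀

sum-map-comm : (h : A → B → ℕ) (xs : List A) (ys : List B) →
  sum (map (λ x → sum (map (h x) ys)) xs) ≡ sum (map (λ y → sum (map (λ x → h x y) xs)) ys)
sum-map-comm h []       ys = sym (trans (sum-map-const 0 ys) (*-zeroʳ (length ys)))
sum-map-comm h (x ∷ xs) ys =
  trans (cong (sum (map (h x) ys) +_) (sum-map-comm h xs ys))
        (sym (sum-map-+ (h x) (λ y → sum (map (λ x′ → h x′ y) xs)) ys))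

module _ (g : A → A → ℕ) (g-comm : ∀ x y → g x y ≡ g y x) (2∣g-diag : ∀ x → 2 ∣ g x x) where

  2∣sum-symmetric : (xs : List A) → 2 ∣ sum (map (λ x → sum (map (g x) xs)) xs)
  2∣sum-symmetric []       = 2 ∣0
  2∣sum-symmetric (x ∷ xs) =
    subst (2 ∣_) (sym split) (∣m∣n⇒∣m+n (∣m∣n⇒∣m+n (2∣g-diag x) (m∣m*n row)) (2∣sum-symmetric xs))
    where
    open ≡-Reasoning
    row rest : ℕ
    row  = sum (map (g x) xs)
    rest = sum (map (λ z → sum (map (g z) xs)) xs)

    regroup : ∀ d t r → d + t + (t + r) ≡ d + 2 * t + r
    regroup = solve-∀

    split : sum (map (λ z → sum (map (g z) (x ∷ xs))) (x ∷ xs)) ≡ g x x + 2 * row + rest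
    split = begin
      g x x + row + sum (map (λ z → g z x + sum (map (g z) xs)) xs)
        ≡⟨ cong (g x x + row +_) (sum-map-+ (λ z → g z x) (λ z → sum (map (g z) xs)) xs) ⟩
      g x x + row + (sum (map (λ z → g z x) xs) + rest)
        ≡⟨ cong (λ column → g x x + row + (column + rest)) (sum-map-cong (λ z → g-comm z x) xs) ⟩
      g x x + row + (row + rest)
        ≡⟨ regroup (g x x) row rest ⟩
      g x x + 2 * row + rest ∎

indicator : {P : Set ℓ} → Dec P → ℕ
indicator (yes _) = 1
indicator (no _)  = 0

indicator-yes : {P : Set ℓ} (P? : Dec P) → P → indicator P? ≡ 1
indicator-yes (yes _) _  = refl
indicator-yes (no ¬p) p = contradiction p ¬p

module _ {P : Pred B ℓ} (P? : Decidable P) where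

  length-filter-++ : (xs ys : List B) →
    length (filter P? (xs ++ ys)) ≡ length (filter P? xs) + length (filter P? ys)
  length-filter-++ xs ys = trans (cong length (filter-++ P? xs ys)) (length-++ (filter P? xs))

  length-filter-[-] : (x : B) → length (filter P? [ x ]) ≡ indicator (P? x)
  length-filter-[-] x with P? x
  ... | yes _ = refl
  ... | no _  = refl

  length-filter-map : (h : A → B) (xs : List A) →
    length (filter P? (map h xs)) ≡ sum (map (λ x → indicator (P? (h x))) xs)
  length-filter-map h []       = refl
  length-filter-map h (x ∷ xs) =
    trans (length-filter-++ [ h x ] (map h xs))
          (cong₂ _+_ (length-filter-[-] (h x)) (length-filter-map h xs))

  length-filter-concatMap : (f : A → List B) (xs : List A) →
    length (filter P? (concatMap f xs)) ≡ sum (map (λ x → length (filter P? (f x))) xs)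
  length-filter-concatMap f []       = refl
  length-filter-concatMap f (x ∷ xs) =
    trans (length-filter-++ (f x) (concatMap f xs))
          (cong (length (filter P? (f x)) +_) (length-filter-concatMap f xs))

size-rhoOf : ∀ m γ σ → size (γ , rhoOf m γ σ , σ) ≡ sum γ + length σ * (m * length γ) + sum σ
size-rhoOf m γ σ = cong (λ r → sum γ + r + sum σ) (sum-map-const (m * length γ) σ)

size-rhoOf-comm : ∀ m γ σ → size (γ , rhoOf m γ σ , σ) ≡ size (σ , rhoOf m σ γ , γ)
size-rhoOf-comm m γ σ = begin
  size (γ , rhoOf m γ σ , σ)                         ≡⟨ size-rhoOf m γ σ ⟩
  sum γ + length σ * (m * length γ) + sum σ          ≡⟨ swap (sum γ) (sum σ) (length σ) (length γ) m ⟩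
  sum σ + length γ * (m * length σ) + sum γ          ≡⟨ size-rhoOf m σ γ ⟨
  size (σ , rhoOf m σ γ , γ)                         ∎
  where
  open ≡-Reasoning
  swap : ∀ x y p q m → x + p * (m * q) + y ≡ y + q * (m * p) + x
  swap = solve-∀

2∣size-rhoOf-diag : ∀ {m} → 2 ∣ m → ∀ γ → 2 ∣ size (γ , rhoOf m γ γ , γ)
2∣size-rhoOf-diag {m} (divides q refl) γ =
  subst (2 ∣_) (sym (trans (size-rhoOf m γ γ) (double (sum γ) (length γ) q)))
        (m∣m*n (sum γ + length γ * (q * length γ)))
  where
  double : ∀ x p q → x + p * (q * 2 * p) + x ≡ 2 * (x + p * (q * p))
  double = solve-∀

hits : ℕ → ℕ → List ℕ → List ℕ → ℕ
hits m n γ σ = indicator (size (γ , rhoOf m γ σ , σ) ≟ n)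

cpBySizes : ℕ → ℕ → ℕ → ℕ → ℕ → ℕ → ℕ
cpBySizes a b m n i j =
  sum (map (λ γ → sum (map (hits m n γ) (partitions (admissible b m) j))) (partitions (admissible a m) i))

cp≡sum-cpBySizes : ∀ a b m n →
  cp a b m n ≡ sum (map (λ i → sum (map (cpBySizes a b m n i) (upTo (suc n)))) (upTo (suc n)))
cp≡sum-cpBySizes a b m n =
  trans (length-filter-concatMap D (λ i → concatMap (byγ i) U) U) (sum-map-cong (λ i →
  trans (length-filter-concatMap D (byγ i) U) (sum-map-cong (λ j →
  trans (length-filter-concatMap D (λ γ → byσ γ j) (Pa i)) (sum-map-cong (λ γ →
  length-filter-map D (λ σ → (γ , rhoOf m γ σ , σ)) (Pb j)) (Pa i))) U)) U)
  where
  U = upTo (suc n)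
  Pa = partitions (admissible a m)
  Pb = partitions (admissible b m)
  D = λ (c : Copart) → size c ≟ n
  byσ : List ℕ → ℕ → List Copart
  byσ γ j = map (λ σ → (γ , rhoOf m γ σ , σ)) (Pb j)
  byγ : ℕ → ℕ → List Copart
  byγ i j = concatMap (λ γ → byσ γ j) (Pa i)

hits-comm : ∀ m n γ σ → hits m n γ σ ≡ hits m n σ γ
hits-comm m n γ σ = cong (indicator ∘ (_≟ n)) (size-rhoOf-comm m γ σ)

cpBySizes-comm : ∀ a m n i j → cpBySizes a a m n i j ≡ cpBySizes a a m n j i
cpBySizes-comm a m n i j =
  trans (sum-map-comm (hits m n) (P i) (P j))
        (sum-map-cong (λ σ → sum-map-cong (λ γ → hits-comm m n γ σ) (P i)) (P j))
  where
  P = partitions (admissible a m)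

2∣cp-odd : ∀ a m → 2 ∣ m → ∀ n → ¬ 2 ∣ n → 2 ∣ cp a a m n
2∣cp-odd a m 2∣m n n-odd =
  subst (2 ∣_) (sym (cp≡sum-cpBySizes a a m n))
    (2∣sum-symmetric (cpBySizes a a m n) (cpBySizes-comm a m n) 2∣cpBySizes-diag (upTo (suc n)))
  where
  2∣hits-diag : ∀ γ → 2 ∣ hits m n γ γ
  2∣hits-diag γ with size (γ , rhoOf m γ γ , γ) ≟ n
  ... | yes size≡n = contradiction (subst (2 ∣_) size≡n (2∣size-rhoOf-diag 2∣m γ)) n-odd
  ... | no _       = 2 ∣0

  2∣cpBySizes-diag : ∀ i → 2 ∣ cpBySizes a a m n i i
  2∣cpBySizes-diag i = 2∣sum-symmetric (hits m n) (hits-comm m n)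
                                       2∣hits-diag (partitions (admissible a m) i)

2∤1 : ¬ 2 ∣ 1
2∤1 2∣1 = contradiction (∣1⇒≡1 2∣1) λ ()

odd-or-odd : ∀ n → ¬ 2 ∣ suc n ⊎ ¬ 2 ∣ suc (suc n)
odd-or-odd n with 2 ∣? suc n
... | no 2∤1+n = inj₁ 2∤1+n
... | yes 2∣1+n = inj₂ λ 2∣2+n → 2∤1 (∣m+n∣m⇒∣n (subst (2 ∣_) (+-comm 1 (suc n)) 2∣2+n) 2∣1+n)

module _ {P : Pred ℕ ℓ} (P? : Decidable P) where

  countUpTo : ℕ → ℕ
  countUpTo n = length (filter P? (map suc (upTo n)))

  countUpTo-suc : ∀ n → countUpTo (suc n) ≡ indicator (P? (suc n)) + countUpTo n
  countUpTo-suc n = begin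
    countUpTo (suc n)                                        ≡⟨ cong (length ∘ filter P? ∘ map suc) (upTo-∷ʳ n) ⟨
    length (filter P? (map suc (upTo n ++ [ n ])))           ≡⟨ cong (length ∘ filter P?) (map-++ suc (upTo n) [ n ]) ⟩
    length (filter P? (map suc (upTo n) ++ [ suc n ]))       ≡⟨ length-filter-++ P? (map suc (upTo n)) [ suc n ] ⟩
    countUpTo n + length (filter P? [ suc n ])               ≡⟨ +-comm (countUpTo n) _ ⟩
    length (filter P? [ suc n ]) + countUpTo n               ≡⟨ cong (_+ countUpTo n) (length-filter-[-] P? (suc n)) ⟩
    indicator (P? (suc n)) + countUpTo n                     ∎
    where open ≡-Reasoning

  countUpTo-≤-suc : ∀ n → countUpTo n ≤ countUpTo (suc n)
  countUpTo-≤-suc n = subst (countUpTo n ≤_) (sym (countUpTo-suc n)) (m≤n+m (countUpTo n) _)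

  countUpTo-<-suc : ∀ n → P (suc n) → suc (countUpTo n) ≤ countUpTo (suc n)
  countUpTo-<-suc n p =
    ≤-reflexive (sym (trans (countUpTo-suc n) (cong (_+ countUpTo n) (indicator-yes (P? (suc n)) p))))

  module _ (odd⇒P : ∀ k → ¬ 2 ∣ k → P k) where

    countUpTo-<-suc-suc : ∀ n → suc (countUpTo n) ≤ countUpTo (suc (suc n))
    countUpTo-<-suc-suc n with odd-or-odd n
    ... | inj₁ 1+n-odd = ≤-trans (countUpTo-<-suc n (odd⇒P _ 1+n-odd)) (countUpTo-≤-suc (suc n))
    ... | inj₂ 2+n-odd = ≤-trans (s≤s (countUpTo-≤-suc n)) (countUpTo-<-suc (suc n) (odd⇒P _ 2+n-odd))

    n≤2*countUpTo : ∀ n → n ≤ 2 * countUpTo n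
    n≤2*countUpTo zero          = z≤n
    n≤2*countUpTo (suc zero)    = ≤-trans (countUpTo-<-suc 0 (odd⇒P 1 2∤1)) (m≤m+n (countUpTo 1) _)
    n≤2*countUpTo (suc (suc n)) = begin
      2 + n                             ≤⟨ s≤s (s≤s (n≤2*countUpTo n)) ⟩
      2 + 2 * countUpTo n               ≡⟨ *-suc 2 (countUpTo n) ⟨
      2 * suc (countUpTo n)             ≤⟨ *-monoʳ-≤ 2 (countUpTo-<-suc-suc n) ⟩
      2 * countUpTo (suc (suc n))       ∎
      where open ≤-Reasoning

corollary3p5 : (a m : ℕ) → 1 ≤ a → 2 ≤ m → 2 ∣ m →
    (k : ℕ) → 1 ≤ k →
    ∃ λ N → (n : ℕ) → N ≤ n → (k ∸ 2) * n ≤ 2 * k * evenCount a m n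
corollary3p5 a m _ _ 2∣m k _ = 0 , λ n _ → begin
  (k ∸ 2) * n                ≤⟨ *-monoˡ-≤ n (m∸n≤m k 2) ⟩
  k * n                      ≤⟨ *-monoʳ-≤ k (n≤2*countUpTo (λ j → 2 ∣? cp a a m j) (2∣cp-odd a m 2∣m) n) ⟩
  k * (2 * evenCount a m n)  ≡⟨ reassociate k (evenCount a m n) ⟩
  2 * k * evenCount a m n    ∎
  where
  open ≤-Reasoning
  reassociate : ∀ k e → k * (2 * e) ≡ 2 * k * e
  reassociate = solve-∀
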